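{- Let $G$ be a connected graph with a split $(X,Y)$. Then $G$ is a Naji graph if and only if $G_X$ and $G_Y$ are both Naji graphs. Moreover, $|\mathcal{B}(G)|\geq|\mathcal{B}(G_X)||\mathcal{B}(G_Y)|/2$.
   Context: All graphs are finite and simple. A split of $G$ is a partition $V(G)=X\cup Y$ with $|X|,|Y|\geq 2$ together with subsets $X'\subseteq X$, $Y'\subseteq Y$ such that the set of edges joining $X$ to $Y$ is exactly $\{xy: x\in X', y\in Y'\}$. $G_X$ is obtained from the induced subgraph $G[X]$ by adding a new vertex $y_0$ with neighborhood $X'$; $G_Y$ is obtained from $G[Y]$ by adding a new vertex $x_0$ with neighborhood $Y'$. For a graph $H$ and each ordered pair $(v,w)$ of distinct vertices there is a variable $\beta(v,w)$. The Naji equations of $H$ are: (a) for each edge $vw$, $\beta(v,w)+\beta(w,v)=1$; (b) if $v,w,x$ are distinct with $vw\in E(H)$ and $vx,wx\notin E(H)$, then $\beta(x,v)+\beta(x,w)=0$; (c) if $v,w,x$ are distinct with $vw,vx\in E(H)$ and $wx\notin E(H)$, then $\beta(v,w)+\beta(v,x)+\beta(w,x)+\beta(x,w)=1$. $\mathcal{B}(H)$ is the set of functions from ordered pairs of distinct vertices to $GF(2)$ satisfying all these equations; $H$ is a Naji graph if $\mathcal{B}(H)\neq\varnothing$. -}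

module Defs where

open import Data.Bool using (Bool; true; false; not; _∧_; _∨_; _xor_; if_then_else_)
open import Data.Nat using (ℕ; zero; suc; _≤_)
open import Data.Fin using (Fin; zero; suc; _≟_)
open import Data.Maybe using (Maybe; just; nothing)
open import Data.List using (List; []; _∷_; length; lookup; allFin; filterᵇ; foldr; concatMap; map)
open import Data.Vec using (Vec; []; _∷_) renaming (lookup to vlookup)
open import Data.Product using (Σ; ∃; _×_; _,_)
open import Relation.Nullary.Decidable using (⌊_⌋)
open import Relation.Binary.PropositionalEquality using (_≡_; refl)

record Graph : Set where
  field
    n     : ℕ
    adj   : Fin n → Fin n → Bool
    sym   : ∀ u v → adj u v ≡ adj v u
    irrefl : ∀ v → adj v v ≡ false
open Graph public

data Walk (G : Graph) : Fin (n G) → Fin (n G) → Set where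
  stay : ∀ {v} → Walk G v v
  step : ∀ {u v w} → adj G u v ≡ true → Walk G v w → Walk G u w

Connected : Graph → Set
Connected G = ∀ u v → Walk G u v

members : ∀ {k} → (Fin k → Bool) → List (Fin k)
members {k} S = filterᵇ S (allFin k)

-- A split: side v ≡ true means v ∈ X, side v ≡ false means v ∈ Y.
-- X' and Y' are the attachment sets.
record Split (G : Graph) : Set where
  field
    side   : Fin (n G) → Bool
    X'     : Fin (n G) → Bool
    Y'     : Fin (n G) → Bool
    X'⊆X   : ∀ v → X' v ≡ true → side v ≡ true
    Y'⊆Y   : ∀ v → Y' v ≡ true → side v ≡ false
    X≥2    : 2 ≤ length (members side)
    Y≥2    : 2 ≤ length (members (λ v → not (side v)))
    cross  : ∀ x y → side x ≡ true → side y ≡ false → adj G x y ≡ (X' x ∧ Y' y)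
open Split public

adjExt : (G : Graph) → (Fin (n G) → Bool) → Maybe (Fin (n G)) → Maybe (Fin (n G)) → Bool
adjExt G A (just u) (just v) = adj G u v
adjExt G A (just u) nothing  = A u
adjExt G A nothing  (just v) = A v
adjExt G A nothing  nothing  = false

adjExt-sym : ∀ G A u v → adjExt G A u v ≡ adjExt G A v u
adjExt-sym G A (just u) (just v) = sym G u v
adjExt-sym G A (just u) nothing  = refl
adjExt-sym G A nothing  (just v) = refl
adjExt-sym G A nothing  nothing  = refl

adjExt-irrefl : ∀ G A v → adjExt G A v v ≡ false
adjExt-irrefl G A (just v) = irrefl G v
adjExt-irrefl G A nothing  = refl

-- piece G S A : the induced subgraph G[S] plus a new vertex (vertex zero)
-- whose neighbourhood is A.  Vertex suc i is the i-th element of S.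
pieceVertex : (G : Graph) (S : Fin (n G) → Bool) →
              Fin (suc (length (members S))) → Maybe (Fin (n G))
pieceVertex G S zero    = nothing
pieceVertex G S (suc i) = just (lookup (members S) i)

piece : (G : Graph) → (S A : Fin (n G) → Bool) → Graph
piece G S A = record
  { n      = suc (length (members S))
  ; adj    = λ a b → adjExt G A (pieceVertex G S a) (pieceVertex G S b)
  ; sym    = λ a b → adjExt-sym G A (pieceVertex G S a) (pieceVertex G S b)
  ; irrefl = λ a → adjExt-irrefl G A (pieceVertex G S a)
  }

G-X : (G : Graph) → Split G → Graph
G-X G s = piece G (side s) (X' s)

G-Y : (G : Graph) → Split G → Graph
G-Y G s = piece G (λ v → not (side s v)) (Y' s)

-- A candidate β is a table t with β(v,w) = t[v][w] in GF(2)=Bool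
-- (addition = xor).  Diagonal entries are normalised to false, so that tables
-- satisfying `solution` correspond bijectively to functions on ordered
-- pairs of distinct vertices satisfying the Naji equations.

allᵇ : ∀ {A : Set} → (A → Bool) → List A → Bool
allᵇ p = foldr (λ x r → p x ∧ r) true

Table : ℕ → Set
Table k = Vec (Vec Bool k) k

β : ∀ {k} → Table k → Fin k → Fin k → Bool
β t v w = vlookup (vlookup t v) w

distinct : ∀ {k} → Fin k → Fin k → Bool
distinct v w = not ⌊ v ≟ w ⌋

_⇒ᵇ_ : Bool → Bool → Bool
a ⇒ᵇ b = not a ∨ b

module _ (H : Graph) (t : Table (n H)) where
  private
    E = adj H
    b = β t
    V = allFin (n H)

  diagOK : Fin (n H) → Bool
  diagOK v = not (b v v)

  eqA : Fin (n H) → Fin (n H) → Bool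
  eqA v w = (distinct v w ∧ E v w) ⇒ᵇ (b v w xor b w v)

  eqB : Fin (n H) → Fin (n H) → Fin (n H) → Bool
  eqB v w x = (distinct v w ∧ distinct v x ∧ distinct w x ∧
               E v w ∧ not (E v x) ∧ not (E w x))
              ⇒ᵇ not (b x v xor b x w)

  eqC : Fin (n H) → Fin (n H) → Fin (n H) → Bool
  eqC v w x = (distinct v w ∧ distinct v x ∧ distinct w x ∧
               E v w ∧ E v x ∧ not (E w x))
              ⇒ᵇ (b v w xor b v x xor b w x xor b x w)

  solution : Bool
  solution =
    allᵇ diagOK V ∧
    allᵇ (λ v → allᵇ (λ w → eqA v w) V) V ∧
    allᵇ (λ v → allᵇ (λ w → allᵇ (λ x → eqB v w x) V) V) V ∧
    allᵇ (λ v → allᵇ (λ w → allᵇ (λ x → eqC v w x) V) V) V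

In𝓑 : (H : Graph) → Table (n H) → Set
In𝓑 H t = solution H t ≡ true

NajiGraph : Graph → Set
NajiGraph H = Σ (Table (n H)) (In𝓑 H)

allVecs : ∀ {A : Set} (k : ℕ) → List A → List (Vec A k)
allVecs zero    xs = [] ∷ []
allVecs (suc k) xs = concatMap (λ x → map (x ∷_) (allVecs k xs)) xs

allTables : (k : ℕ) → List (Table k)
allTables k = allVecs k (allVecs k (false ∷ true ∷ []))

#𝓑 : Graph → ℕ
#𝓑 H = length (filterᵇ (solution H) (allTables (n H)))

-- A solution of the Naji equations of G restricts to G_X by sending the new vertex y₀ to
-- some y ∈ Y′, and to G_Y by sending x₀ to some x ∈ X′; connectivity provides an edge
-- between X and Y, hence such x and y, and these vertex maps are induced embeddings.
-- Conversely, solutions β_X and β_Y of the pieces glue to a solution of G: keep them on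
-- X × X and Y × Y and put, for x ∈ X and y ∈ Y,
--   β(x,y) = β_X(x,y₀) + [x ∈ X′] β_Y(x₀,y),   β(y,x) = β_Y(y,x₀) + [y ∈ Y′] (1 + β_X(y₀,x)).
-- Each Naji equation of G is then the sum of at most two Naji equations of the pieces.
-- For fixed x ∈ X′ and y ∈ Y′, the glued solution together with the bit β_X(x,y₀)
-- determines β_X and β_Y, so the gluing map 𝓑(G_X) × 𝓑(G_Y) → 𝓑(G) is at most two-to-one.

module Submission where

open import Defs hiding (sym)
open import Data.Bool using (Bool; true; false; not; _∧_; _xor_; T?)
open import Data.Bool.Properties
  using (∧-conicalˡ; ∧-conicalʳ; ∧-identityʳ; xor-comm; xor-identityʳ; T-≡; not-injective)
open import Data.Bool.Solver using (module xor-∧-Solver)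
open import Data.Empty using (⊥-elim)
open import Data.Fin using (Fin; zero; suc; _≟_; combine; remQuot)
open import Data.Fin.Properties using (injective⇒≤; combine-injective; combine-remQuot; 2↔Bool)
open import Data.List
  using (List; []; _∷_; _++_; allFin; length; lookup; filterᵇ; map; concatMap; cartesianProductWith)
open import Data.List.Relation.Unary.Any using (here; there; index)
open import Data.List.Relation.Unary.Any.Properties using (lookup-index)
open import Data.List.Relation.Unary.AllPairs using ([]; _∷_)
open import Data.List.Relation.Unary.Unique.Propositional using (Unique)
open import Data.List.Relation.Unary.Unique.Propositional.Properties
  using (filter⁺; allFin⁺; cartesianProductWith⁺)
open import Data.Maybe using (just; nothing)
open import Data.Maybe.Properties using (just-injective)
open import Data.List.Membership.Propositional using (_∈_)
open import Data.List.Membership.Propositional.Properties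
  using (∈-allFin; ∈-filter⁺; ∈-filter⁻; ∈-lookup; ∈-cartesianProductWith⁺)
open import Data.List.Relation.Unary.All as All using (All; []; _∷_)
open import Data.Nat using (ℕ; suc; _*_; _≤_; _<_; s≤s; z≤n)
open import Data.Nat.Properties using (≤-trans)
open import Data.Vec using (Vec; []; _∷_; tabulate) renaming (lookup to vlookup)
open import Data.Vec.Properties using (lookup∘tabulate; tabulate∘lookup; tabulate-cong; ∷-injective)
open import Data.Product using (∃; ∃₂; _×_; _,_; proj₁; proj₂; uncurry)
open import Function.Base using (_∘_)
open import Function.Bundles using (_⇔_; mk⇔; Equivalence; Inverse)
open import Relation.Nullary using (yes; no)
open import Relation.Binary.PropositionalEquality
  using (_≡_; _≢_; refl; sym; trans; cong; cong₂; subst; module ≡-Reasoning)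

open Equivalence using (to; from)

private
  variable
    a b a₁ a₂ a₃ a₄ a₅ a₆ : Bool
    k : ℕ

∧-true⇔ : (a ∧ b) ≡ true ⇔ (a ≡ true × b ≡ true)
∧-true⇔ {a} {b} = mk⇔ (λ h → ∧-conicalˡ a b h , ∧-conicalʳ a b h) (λ { (refl , refl) → refl })

∧₄-true⇔ : (a₁ ∧ a₂ ∧ a₃ ∧ a₄) ≡ true ⇔ (a₁ ≡ true × a₂ ≡ true × a₃ ≡ true × a₄ ≡ true)
∧₄-true⇔ = mk⇔ elim intro
  where
  elim : (a₁ ∧ a₂ ∧ a₃ ∧ a₄) ≡ true → a₁ ≡ true × a₂ ≡ true × a₃ ≡ true × a₄ ≡ true
  elim {true} {true} {true} {true} refl = refl , refl , refl , refl
  intro : a₁ ≡ true × a₂ ≡ true × a₃ ≡ true × a₄ ≡ true → (a₁ ∧ a₂ ∧ a₃ ∧ a₄) ≡ true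
  intro (refl , refl , refl , refl) = refl

∧₆-true⇔ : (a₁ ∧ a₂ ∧ a₃ ∧ a₄ ∧ a₅ ∧ a₆) ≡ true ⇔
           (a₁ ≡ true × a₂ ≡ true × a₃ ≡ true × a₄ ≡ true × a₅ ≡ true × a₆ ≡ true)
∧₆-true⇔ = mk⇔ elim intro
  where
  elim : (a₁ ∧ a₂ ∧ a₃ ∧ a₄ ∧ a₅ ∧ a₆) ≡ true →
         a₁ ≡ true × a₂ ≡ true × a₃ ≡ true × a₄ ≡ true × a₅ ≡ true × a₆ ≡ true
  elim {true} {true} {true} {true} {true} {true} refl = refl , refl , refl , refl , refl , refl
  intro : a₁ ≡ true × a₂ ≡ true × a₃ ≡ true × a₄ ≡ true × a₅ ≡ true × a₆ ≡ true →
          (a₁ ∧ a₂ ∧ a₃ ∧ a₄ ∧ a₅ ∧ a₆) ≡ true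
  intro (refl , refl , refl , refl , refl , refl) = refl

∧≡false⇒ˡ : (a ∧ b) ≡ false → b ≡ true → a ≡ false
∧≡false⇒ˡ {a} e refl = trans (sym (∧-identityʳ a)) e

∧≡false⇒ʳ : (a ∧ b) ≡ false → a ≡ true → b ≡ false
∧≡false⇒ʳ e refl = e

xor-false∧ : ∀ c → a ≡ false → (c xor (a ∧ b)) ≡ c
xor-false∧ c refl = xor-identityʳ c

xor-cancelˡ : ∀ {a′ b′} → (a xor b) ≡ (a′ xor b′) → a ≡ a′ → b ≡ b′
xor-cancelˡ {true}  e refl = not-injective e
xor-cancelˡ {false} e refl = e

xor-cancelʳ : ∀ {a′ b′} → (a xor b) ≡ (a′ xor b′) → b ≡ b′ → a ≡ a′
xor-cancelʳ {a} {b} {a′} e refl = xor-cancelˡ {b} (trans (xor-comm b a) (trans e (xor-comm a′ b))) refl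

xor-∧-cancelˡ : ∀ {c a′ b′} → c ≡ true → (a xor (c ∧ b)) ≡ (a′ xor (c ∧ b′)) → a ≡ a′ → b ≡ b′
xor-∧-cancelˡ refl = xor-cancelˡ

⇒ᵇ-true⇔ : (a ⇒ᵇ b) ≡ true ⇔ (a ≡ true → b ≡ true)
⇒ᵇ-true⇔ {true}  = mk⇔ (λ h _ → h) (λ h → h refl)
⇒ᵇ-true⇔ {false} = mk⇔ (λ _ ()) (λ _ → refl)

not-true⇔ : not a ≡ true ⇔ a ≡ false
not-true⇔ = mk⇔ not-injective (cong not)

not-xor-true⇔ : not (a xor b) ≡ true ⇔ a ≡ b
not-xor-true⇔ = mk⇔ elim intro
  where
  elim : not (a xor b) ≡ true → a ≡ b
  elim {true} {true} _ = refl
  elim {false} {false} _ = refl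
  intro : a ≡ b → not (a xor b) ≡ true
  intro {true} refl = refl
  intro {false} refl = refl

distinct-true⇔ : {v w : Fin k} → distinct v w ≡ true ⇔ v ≢ w
distinct-true⇔ {v = v} {w} with v ≟ w
... | yes v≡w = mk⇔ (λ ()) (λ v≢w → ⊥-elim (v≢w v≡w))
... | no v≢w  = mk⇔ (λ _ → v≢w) (λ _ → refl)

allᵇ-true⇔ : ∀ {A : Set} {p : A → Bool} {xs} → allᵇ p xs ≡ true ⇔ All (λ x → p x ≡ true) xs
allᵇ-true⇔ {xs = []}     = mk⇔ (λ _ → []) (λ _ → refl)
allᵇ-true⇔ {xs = x ∷ xs} = mk⇔
  (λ h → let px , rest = to ∧-true⇔ h in px ∷ to allᵇ-true⇔ rest)
  (λ { (px ∷ rest) → from ∧-true⇔ (px , from allᵇ-true⇔ rest) })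

allᵇ-allFin⇔ : ∀ {k} (p : Fin k → Bool) → allᵇ p (allFin k) ≡ true ⇔ (∀ i → p i ≡ true)
allᵇ-allFin⇔ {k} p = mk⇔
  (λ h i → All.lookup (to (allᵇ-true⇔ {p = p} {xs = allFin k}) h) (∈-allFin i))
  (λ h → from (allᵇ-true⇔ {p = p} {xs = allFin k}) (All.tabulate (λ {i} _ → h i)))

allᵇ²-allFin⇔ : ∀ {k} (r : Fin k → Fin k → Bool) →
  allᵇ (λ v → allᵇ (r v) (allFin k)) (allFin k) ≡ true ⇔ (∀ v w → r v w ≡ true)
allᵇ²-allFin⇔ r = mk⇔
  (λ h v → to (allᵇ-allFin⇔ (r v)) (to (allᵇ-allFin⇔ _) h v))
  (λ h → from (allᵇ-allFin⇔ _) λ v → from (allᵇ-allFin⇔ (r v)) (h v))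

allᵇ³-allFin⇔ : ∀ {k} (r : Fin k → Fin k → Fin k → Bool) →
  allᵇ (λ v → allᵇ (λ w → allᵇ (r v w) (allFin k)) (allFin k)) (allFin k) ≡ true ⇔
  (∀ v w x → r v w x ≡ true)
allᵇ³-allFin⇔ r = mk⇔
  (λ h v → to (allᵇ²-allFin⇔ (r v)) (to (allᵇ-allFin⇔ _) h v))
  (λ h → from (allᵇ-allFin⇔ _) λ v → from (allᵇ²-allFin⇔ (r v)) (h v))

module _ (H : Graph) (b : Fin (n H) → Fin (n H) → Bool) where

  NajiA : Fin (n H) → Fin (n H) → Set
  NajiA v w = v ≢ w → adj H v w ≡ true → (b v w xor b w v) ≡ true

  NajiB : Fin (n H) → Fin (n H) → Fin (n H) → Set
  NajiB v w x = v ≢ w → v ≢ x → w ≢ x →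
    adj H v w ≡ true → adj H v x ≡ false → adj H w x ≡ false → b x v ≡ b x w

  NajiC : Fin (n H) → Fin (n H) → Fin (n H) → Set
  NajiC v w x = v ≢ w → v ≢ x → w ≢ x →
    adj H v w ≡ true → adj H v x ≡ true → adj H w x ≡ false →
    (b v w xor b v x xor b w x xor b x w) ≡ true

  record NajiSolution : Set where
    field
      diag   : ∀ v → b v v ≡ false
      naji-a : ∀ v w → NajiA v w
      naji-b : ∀ v w x → NajiB v w x
      naji-c : ∀ v w x → NajiC v w x

module _ (H : Graph) (b : Fin (n H) → Fin (n H) → Bool) where

  NajiA-swap : ∀ {v w} → NajiA H b w v → NajiA H b v w
  NajiA-swap {v} {w} h v≢w vw =
    trans (xor-comm (b v w) (b w v)) (h (λ e → v≢w (sym e)) (trans (Graph.sym H w v) vw))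

  NajiB-swap : ∀ {v w x} → NajiB H b w v x → NajiB H b v w x
  NajiB-swap h v≢w v≢x w≢x vw vx wx =
    sym (h (λ e → v≢w (sym e)) w≢x v≢x (trans (Graph.sym H _ _) vw) wx vx)

  NajiC-swap : ∀ {v w x} → NajiC H b v x w → NajiC H b v w x
  NajiC-swap {v} {w} {x} h v≢w v≢x w≢x vw vx wx =
    trans (xor-swap (b v w) (b v x) (b w x) (b x w))
      (h v≢x v≢w (λ e → w≢x (sym e)) vx vw (trans (Graph.sym H x w) wx))
    where
    open xor-∧-Solver
    xor-swap : ∀ p q r t → (p xor q xor r xor t) ≡ (q xor p xor t xor r)
    xor-swap = solve 4 (λ p q r t → p :+ (q :+ (r :+ t)) := q :+ (p :+ (t :+ r))) refl

module _ {H : Graph} {t : Table (n H)} where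

  eqA-true⇔ : ∀ {v w} → eqA H t v w ≡ true ⇔ NajiA H (β t) v w
  eqA-true⇔ = mk⇔
    (λ h v≢w vw → to ⇒ᵇ-true⇔ h (from ∧-true⇔ (from distinct-true⇔ v≢w , vw)))
    (λ h → from ⇒ᵇ-true⇔ λ p →
      let d , vw = to ∧-true⇔ p in h (to distinct-true⇔ d) vw)

  eqB-true⇔ : ∀ {v w x} → eqB H t v w x ≡ true ⇔ NajiB H (β t) v w x
  eqB-true⇔ = mk⇔
    (λ h v≢w v≢x w≢x vw vx wx → to not-xor-true⇔ (to ⇒ᵇ-true⇔ h (from ∧₆-true⇔
      ( from distinct-true⇔ v≢w , from distinct-true⇔ v≢x , from distinct-true⇔ w≢x
      , vw , from not-true⇔ vx , from not-true⇔ wx))))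
    (λ h → from ⇒ᵇ-true⇔ λ p →
      let d₁ , d₂ , d₃ , vw , vx , wx = to ∧₆-true⇔ p
      in from not-xor-true⇔ (h (to distinct-true⇔ d₁) (to distinct-true⇔ d₂) (to distinct-true⇔ d₃)
                               vw (to not-true⇔ vx) (to not-true⇔ wx)))

  eqC-true⇔ : ∀ {v w x} → eqC H t v w x ≡ true ⇔ NajiC H (β t) v w x
  eqC-true⇔ = mk⇔
    (λ h v≢w v≢x w≢x vw vx wx → to ⇒ᵇ-true⇔ h (from ∧₆-true⇔
      ( from distinct-true⇔ v≢w , from distinct-true⇔ v≢x , from distinct-true⇔ w≢x
      , vw , vx , from not-true⇔ wx)))
    (λ h → from ⇒ᵇ-true⇔ λ p →
      let d₁ , d₂ , d₃ , vw , vx , wx = to ∧₆-true⇔ p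
      in h (to distinct-true⇔ d₁) (to distinct-true⇔ d₂) (to distinct-true⇔ d₃) vw vx (to not-true⇔ wx))

  In𝓑⇔NajiSolution : In𝓑 H t ⇔ NajiSolution H (β t)
  In𝓑⇔NajiSolution = mk⇔
    (λ h → let hd , ha , hb , hc = to conjuncts h in record
      { diag   = λ v → to not-true⇔ (to (allᵇ-allFin⇔ (diagOK H t)) hd v)
      ; naji-a = λ v w → to eqA-true⇔ (to (allᵇ²-allFin⇔ (eqA H t)) ha v w)
      ; naji-b = λ v w x → to eqB-true⇔ (to (allᵇ³-allFin⇔ (eqB H t)) hb v w x)
      ; naji-c = λ v w x → to eqC-true⇔ (to (allᵇ³-allFin⇔ (eqC H t)) hc v w x)
      })
    (λ S → let open NajiSolution S in from conjuncts
      ( from (allᵇ-allFin⇔ (diagOK H t)) (λ v → from not-true⇔ (diag v))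
      , from (allᵇ²-allFin⇔ (eqA H t)) (λ v w → from eqA-true⇔ (naji-a v w))
      , from (allᵇ³-allFin⇔ (eqB H t)) (λ v w x → from eqB-true⇔ (naji-b v w x))
      , from (allᵇ³-allFin⇔ (eqC H t)) (λ v w x → from eqC-true⇔ (naji-c v w x))))
    where
    V = allFin (n H)
    conjuncts : In𝓑 H t ⇔
      ( allᵇ (diagOK H t) V ≡ true
      × allᵇ (λ v → allᵇ (eqA H t v) V) V ≡ true
      × allᵇ (λ v → allᵇ (λ w → allᵇ (eqB H t v w) V) V) V ≡ true
      × allᵇ (λ v → allᵇ (λ w → allᵇ (eqC H t v w) V) V) V ≡ true)
    conjuncts = ∧₄-true⇔

tabulate₂ : (Fin k → Fin k → Bool) → Table k
tabulate₂ f = tabulate (λ v → tabulate (f v))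

β-tabulate₂ : (f : Fin k → Fin k → Bool) → ∀ v w → β (tabulate₂ f) v w ≡ f v w
β-tabulate₂ f v w rewrite lookup∘tabulate (λ v → tabulate (f v)) v = lookup∘tabulate (f v) w

Vec-ext : ∀ {A : Set} {xs ys : Vec A k} → (∀ i → vlookup xs i ≡ vlookup ys i) → xs ≡ ys
Vec-ext {xs = xs} {ys} h = trans (sym (tabulate∘lookup xs)) (trans (tabulate-cong h) (tabulate∘lookup ys))

Table-ext : {t t' : Table k} → (∀ v w → β t v w ≡ β t' v w) → t ≡ t'
Table-ext h = Vec-ext (λ v → Vec-ext (h v))

record InducedEmbedding (K H : Graph) : Set where
  field
    embed     : Fin (n K) → Fin (n H)
    injective : ∀ {a c} → embed a ≡ embed c → a ≡ c
    adj-embed : ∀ a c → adj H (embed a) (embed c) ≡ adj K a c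

id-embedding : ∀ {H} → InducedEmbedding H H
id-embedding = record { embed = λ v → v ; injective = λ e → e ; adj-embed = λ _ _ → refl }

module _ {K H : Graph} (φ : InducedEmbedding K H) where
  open InducedEmbedding φ

  NajiSolution-pullback : ∀ {b b'} → (∀ a c → b' a c ≡ b (embed a) (embed c)) →
    NajiSolution H b → NajiSolution K b'
  NajiSolution-pullback {b} {b'} b'≡ S = record
    { diag   = λ v → trans (b'≡ v v) (diag (embed v))
    ; naji-a = λ v w v≢w vw →
        subst (_≡ true) (sym (cong₂ _xor_ (b'≡ v w) (b'≡ w v)))
          (naji-a (embed v) (embed w) (≢-embed v≢w) (edge vw))
    ; naji-b = λ v w x v≢w v≢x w≢x vw vx wx →
        trans (b'≡ x v) (trans
          (naji-b (embed v) (embed w) (embed x) (≢-embed v≢w) (≢-embed v≢x) (≢-embed w≢x)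
            (edge vw) (edge vx) (edge wx))
          (sym (b'≡ x w)))
    ; naji-c = λ v w x v≢w v≢x w≢x vw vx wx →
        subst (_≡ true)
          (sym (cong₂ _xor_ (b'≡ v w) (cong₂ _xor_ (b'≡ v x) (cong₂ _xor_ (b'≡ w x) (b'≡ x w)))))
          (naji-c (embed v) (embed w) (embed x) (≢-embed v≢w) (≢-embed v≢x) (≢-embed w≢x)
            (edge vw) (edge vx) (edge wx))
    }
    where
    open NajiSolution S
    ≢-embed : ∀ {a c} → a ≢ c → embed a ≢ embed c
    ≢-embed a≢c e = a≢c (injective e)
    edge : ∀ {a c e} → adj K a c ≡ e → adj H (embed a) (embed c) ≡ e
    edge = trans (adj-embed _ _)

NajiSolution⇒NajiGraph : ∀ {H b} → NajiSolution H b → NajiGraph H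
NajiSolution⇒NajiGraph {b = b} S =
  tabulate₂ b ,
  from (In𝓑⇔NajiSolution {t = tabulate₂ b}) (NajiSolution-pullback id-embedding (β-tabulate₂ b) S)

NajiGraph-induced : ∀ {K H} → InducedEmbedding K H → NajiGraph H → NajiGraph K
NajiGraph-induced φ (t , t∈𝓑) =
  NajiSolution⇒NajiGraph (NajiSolution-pullback φ (λ _ _ → refl) (to (In𝓑⇔NajiSolution {t = t}) t∈𝓑))

lookup-injective : ∀ {A : Set} {xs : List A} → Unique xs → ∀ {i j} → lookup xs i ≡ lookup xs j → i ≡ j
lookup-injective (_ ∷ _)  {zero}  {zero}  _ = refl
lookup-injective (x∉ ∷ _) {zero}  {suc j} e = ⊥-elim (All.lookup x∉ (∈-lookup j) e)
lookup-injective (x∉ ∷ _) {suc i} {zero}  e = ⊥-elim (All.lookup x∉ (∈-lookup i) (sym e))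
lookup-injective (_ ∷ u)  {suc i} {suc j} e = cong suc (lookup-injective u e)

module _ {A : Set} (p : A → Bool) where

  ∈-filterᵇ⁺ : ∀ {x xs} → x ∈ xs → p x ≡ true → x ∈ filterᵇ p xs
  ∈-filterᵇ⁺ x∈xs px = ∈-filter⁺ (T? ∘ p) x∈xs (from T-≡ px)

  ∈-filterᵇ⁻ : ∀ {x} xs → x ∈ filterᵇ p xs → p x ≡ true
  ∈-filterᵇ⁻ xs x∈ = to T-≡ (proj₂ (∈-filter⁻ (T? ∘ p) {xs = xs} x∈))

  filterᵇ-unique : ∀ {xs} → Unique xs → Unique (filterᵇ p xs)
  filterᵇ-unique = filter⁺ (T? ∘ p)

module _ (S : Fin k → Bool) where

  ∈-members⁺ : ∀ {u} → S u ≡ true → u ∈ members S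
  ∈-members⁺ = ∈-filterᵇ⁺ S (∈-allFin _)

  ∈-members⁻ : ∀ {u} → u ∈ members S → S u ≡ true
  ∈-members⁻ = ∈-filterᵇ⁻ S (allFin _)

  members-unique : Unique (members S)
  members-unique = filterᵇ-unique S (allFin⁺ _)

  members-inhabited : 0 < length (members S) → ∃ λ u → S u ≡ true
  members-inhabited _ with members S in eq
  ... | u ∷ _ = u , ∈-members⁻ (subst (u ∈_) (sym eq) (here refl))

-- Counting solutions

concatMap-map≡cartesianProductWith : ∀ {A B C : Set} (f : A → B → C) xs ys →
  concatMap (λ x → map (f x) ys) xs ≡ cartesianProductWith f xs ys
concatMap-map≡cartesianProductWith f []       ys = refl
concatMap-map≡cartesianProductWith f (x ∷ xs) ys =
  cong (map (f x) ys ++_) (concatMap-map≡cartesianProductWith f xs ys)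

module _ {A : Set} {xs : List A} where

  ∈-allVecs : (∀ a → a ∈ xs) → ∀ {k} (v : Vec A k) → v ∈ allVecs k xs
  ∈-allVecs all∈ []      = here refl
  ∈-allVecs all∈ {suc k} (a ∷ v) =
    subst (a ∷ v ∈_) (sym (concatMap-map≡cartesianProductWith _∷_ xs (allVecs k xs)))
      (∈-cartesianProductWith⁺ _∷_ (all∈ a) (∈-allVecs all∈ v))

  allVecs-unique : Unique xs → ∀ k → Unique (allVecs k xs)
  allVecs-unique u 0       = [] ∷ []
  allVecs-unique u (suc k) =
    subst Unique (sym (concatMap-map≡cartesianProductWith _∷_ xs (allVecs k xs)))
      (cartesianProductWith⁺ _∷_ ∷-injective u (allVecs-unique u k))

∈-allTables : (t : Table k) → t ∈ allTables k
∈-allTables = ∈-allVecs (∈-allVecs λ { false → here refl ; true → there (here refl) })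

allTables-unique : ∀ k → Unique (allTables k)
allTables-unique k = allVecs-unique (allVecs-unique (((λ ()) ∷ []) ∷ [] ∷ []) k) k

𝓑 : (H : Graph) → List (Table (n H))
𝓑 H = filterᵇ (solution H) (allTables (n H))

module _ (H : Graph) where

  ∈-𝓑⁺ : ∀ {t} → In𝓑 H t → t ∈ 𝓑 H
  ∈-𝓑⁺ = ∈-filterᵇ⁺ (solution H) (∈-allTables _)

  ∈-𝓑⁻ : ∀ {t} → t ∈ 𝓑 H → In𝓑 H t
  ∈-𝓑⁻ = ∈-filterᵇ⁻ (solution H) (allTables (n H))

  𝓑-unique : Unique (𝓑 H)
  𝓑-unique = filterᵇ-unique (solution H) (allTables-unique (n H))

length*length≤ : ∀ {A B C : Set} {xs : List A} {ys : List B} {zs : List C} →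
  Unique xs → Unique ys → (f : A → B → C) (colour : A → Fin k) →
  (∀ {x y} → x ∈ xs → y ∈ ys → f x y ∈ zs) →
  (∀ {x y x′ y′} → x ∈ xs → y ∈ ys → x′ ∈ xs → y′ ∈ ys →
     colour x ≡ colour x′ → f x y ≡ f x′ y′ → x ≡ x′ × y ≡ y′) →
  length xs * length ys ≤ k * length zs
length*length≤ {k} {xs = xs} {ys} {zs} xs-unique ys-unique f colour f∈ f-injective =
  injective⇒≤ encode-injective
  where
  pair-code : Fin (length xs) × Fin (length ys) → Fin (k * length zs)
  pair-code (i , j) = combine (colour (lookup xs i)) (index (f∈ (∈-lookup i) (∈-lookup j)))
  pair-code-injective : ∀ {p q} → pair-code p ≡ pair-code q → p ≡ q
  pair-code-injective {i , j} {i′ , j′} e =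
    let same-colour , same-index = combine-injective _ _ _ _ e
        same-f = trans (lookup-index (f∈ (∈-lookup i) (∈-lookup j)))
                   (trans (cong (lookup zs) same-index) (sym (lookup-index (f∈ (∈-lookup i′) (∈-lookup j′)))))
        x≡x′ , y≡y′ = f-injective (∈-lookup i) (∈-lookup j) (∈-lookup i′) (∈-lookup j′) same-colour same-f
    in cong₂ _,_ (lookup-injective xs-unique x≡x′) (lookup-injective ys-unique y≡y′)
  encode : Fin (length xs * length ys) → Fin (k * length zs)
  encode = pair-code ∘ remQuot (length ys)
  encode-injective : ∀ {a c} → encode a ≡ encode c → a ≡ c
  encode-injective {a} {c} e = trans (sym (combine-remQuot {length xs} (length ys) a))
    (trans (cong (uncurry combine) (pair-code-injective e)) (combine-remQuot {length xs} (length ys) c))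

-- The pieces G_X and G_Y

module Piece (G : Graph) (S A : Fin (n G) → Bool) where
  open import Data.List.Membership.DecPropositional (_≟_ {n G}) using (_∈?_)

  P : Graph
  P = piece G S A

  toPiece : Fin (n G) → Fin (n P)
  toPiece u with u ∈? members S
  ... | yes u∈S = suc (index u∈S)
  ... | no _    = zero

  pieceVertex-toPiece : ∀ {u} → S u ≡ true → pieceVertex G S (toPiece u) ≡ just u
  pieceVertex-toPiece {u} Su with u ∈? members S
  ... | yes u∈S = cong just (sym (lookup-index u∈S))
  ... | no u∉S  = ⊥-elim (u∉S (∈-members⁺ S Su))

  pieceVertex-injective : ∀ {a c} → pieceVertex G S a ≡ pieceVertex G S c → a ≡ c
  pieceVertex-injective {zero}  {zero}  _ = refl
  pieceVertex-injective {suc i} {suc j} e = cong suc (lookup-injective (members-unique S) (just-injective e))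

  toPiece-injective : ∀ {u v} → S u ≡ true → S v ≡ true → toPiece u ≡ toPiece v → u ≡ v
  toPiece-injective Su Sv e = just-injective (begin
    just _                      ≡⟨ pieceVertex-toPiece Su ⟨
    pieceVertex G S (toPiece _) ≡⟨ cong (pieceVertex G S) e ⟩
    pieceVertex G S (toPiece _) ≡⟨ pieceVertex-toPiece Sv ⟩
    just _                      ∎)
    where open ≡-Reasoning

  toPiece-≢ : ∀ {u v} → S u ≡ true → S v ≡ true → u ≢ v → toPiece u ≢ toPiece v
  toPiece-≢ Su Sv u≢v e = u≢v (toPiece-injective Su Sv e)

  toPiece≢new : ∀ {u} → S u ≡ true → toPiece u ≢ zero
  toPiece≢new Su e with () ← trans (sym (pieceVertex-toPiece Su)) (cong (pieceVertex G S) e)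

  new≢toPiece : ∀ {u} → S u ≡ true → zero ≢ toPiece u
  new≢toPiece Su e = toPiece≢new Su (sym e)

  adj-toPiece : ∀ {u v} → S u ≡ true → S v ≡ true → adj P (toPiece u) (toPiece v) ≡ adj G u v
  adj-toPiece Su Sv = cong₂ (adjExt G A) (pieceVertex-toPiece Su) (pieceVertex-toPiece Sv)

  adj-toPiece-new : ∀ {u} → S u ≡ true → adj P (toPiece u) zero ≡ A u
  adj-toPiece-new Su = cong (λ p → adjExt G A p nothing) (pieceVertex-toPiece Su)

  adj-new-toPiece : ∀ {u} → S u ≡ true → adj P zero (toPiece u) ≡ A u
  adj-new-toPiece Su = cong (adjExt G A nothing) (pieceVertex-toPiece Su)

  data PieceView : Fin (n P) → Set where
    new : PieceView zero
    old : ∀ {u} → S u ≡ true → PieceView (toPiece u)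

  pieceView : ∀ a → PieceView a
  pieceView zero    = new
  pieceView (suc i) = subst PieceView (pieceVertex-injective (pieceVertex-toPiece Su)) (old Su)
    where Su = ∈-members⁻ S (∈-lookup i)

  piece-embedding : ∀ z → S z ≡ false → (∀ u → S u ≡ true → adj G u z ≡ A u) →
    InducedEmbedding P G
  piece-embedding z Sz adj-z = record { embed = ι ; injective = injective ; adj-embed = adj-ι }
    where
    ι : Fin (n P) → Fin (n G)
    ι zero    = z
    ι (suc i) = lookup (members S) i
    S-ι : ∀ i → S (ι (suc i)) ≡ true
    S-ι i = ∈-members⁻ S (∈-lookup i)
    injective : ∀ {a c} → ι a ≡ ι c → a ≡ c
    injective {zero}  {zero}  _ = refl
    injective {zero}  {suc j} e with () ← trans (sym Sz) (trans (cong S e) (S-ι j))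
    injective {suc i} {zero}  e with () ← trans (sym Sz) (trans (cong S (sym e)) (S-ι i))
    injective {suc i} {suc j} e = cong suc (lookup-injective (members-unique S) e)
    adj-ι : ∀ a c → adj G (ι a) (ι c) ≡ adj P a c
    adj-ι zero    zero    = irrefl G z
    adj-ι zero    (suc j) = trans (Graph.sym G z _) (adj-z _ (S-ι j))
    adj-ι (suc i) zero    = adj-z _ (S-ι i)
    adj-ι (suc i) (suc j) = refl

module _ (G : Graph) (s : Split G) where

  walk-crosses : ∀ {u v} → Walk G u v → side s u ≡ true → side s v ≡ false →
    ∃₂ λ x y → X' s x ≡ true × Y' s y ≡ true
  walk-crosses stay su sv with () ← trans (sym su) sv
  walk-crosses {u} (step {v = w} uw walk) su sv with side s w in sw
  ... | true  = walk-crosses walk sw sv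
  ... | false = u , w , to ∧-true⇔ (trans (sym (cross s u w su sw)) uw)

  attachments : Connected G → ∃₂ λ x y → X' s x ≡ true × Y' s y ≡ true
  attachments conn =
    let u , Su = members-inhabited (side s) (≤-trans (s≤s z≤n) (X≥2 s))
        v , Sv = members-inhabited (λ v → not (side s v)) (≤-trans (s≤s z≤n) (Y≥2 s))
    in walk-crosses (conn u v) Su (to not-true⇔ Sv)

  NajiGraph-G-X : ∀ {y} → Y' s y ≡ true → NajiGraph G → NajiGraph (G-X G s)
  NajiGraph-G-X {y} Y'y = NajiGraph-induced (Piece.piece-embedding G (side s) (X' s) y Sy adj-y)
    where
    Sy = Y'⊆Y s y Y'y
    adj-y : ∀ u → side s u ≡ true → adj G u y ≡ X' s u
    adj-y u Su = trans (cross s u y Su Sy) (trans (cong (X' s u ∧_) Y'y) (∧-identityʳ _))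

  NajiGraph-G-Y : ∀ {x} → X' s x ≡ true → NajiGraph G → NajiGraph (G-Y G s)
  NajiGraph-G-Y {x} X'x = NajiGraph-induced (Piece.piece-embedding G _ (Y' s) x (cong not Sx) adj-x)
    where
    Sx = X'⊆X s x X'x
    adj-x : ∀ u → not (side s u) ≡ true → adj G u x ≡ Y' s u
    adj-x u Su = trans (Graph.sym G u x) (trans (cross s x u Sx (to not-true⇔ Su)) (cong (_∧ Y' s u) X'x))

-- Gluing solutions of the pieces

module _ where
  open xor-∧-Solver

  xor-sum : ∀ {e a b} → e ≡ (a xor b) xor true → a ≡ true → b ≡ true → e ≡ true
  xor-sum eq refl refl = eq

  xor-a-XY : ∀ p q r t {x y} → x ≡ true → y ≡ true → (p xor t) ≡ true → (q xor r) ≡ true →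
    ((p xor (x ∧ q)) xor (r xor (y ∧ not t))) ≡ true
  xor-a-XY p q r t refl refl = xor-sum
    (solve 4 (λ p q r t → (p :+ q) :+ (r :+ (con true :+ t)) := ((p :+ t) :+ (q :+ r)) :+ con true)
      refl p q r t)

  xor-c-XXY : ∀ a b c d e f {x₁ x₂ y} → x₁ ≡ true → x₂ ≡ false → y ≡ true →
    (a xor b xor c xor d) ≡ true → (e xor f) ≡ true →
    (a xor (b xor (x₁ ∧ e)) xor (c xor (x₂ ∧ e)) xor (f xor (y ∧ not d))) ≡ true
  xor-c-XXY a b c d e f refl refl refl = xor-sum
    (solve 6 (λ a b c d e f →
        a :+ ((b :+ e) :+ ((c :+ con false) :+ (f :+ (con true :+ d))))
      := ((a :+ (b :+ (c :+ d))) :+ (e :+ f)) :+ con true)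
      refl a b c d e f)

  xor-c-XYY : ∀ p a b c d {x} → x ≡ true → (a xor b xor c xor d) ≡ true →
    ((p xor (x ∧ a)) xor (p xor (x ∧ b)) xor c xor d) ≡ true
  xor-c-XYY p a b c d refl = trans
    (solve 5 (λ p a b c d → (p :+ a) :+ ((p :+ b) :+ (c :+ d)) := a :+ (b :+ (c :+ d))) refl p a b c d)

  xor-c-YXX : ∀ p a b c d {y} → y ≡ true → (a xor b xor c xor d) ≡ true →
    ((p xor (y ∧ not a)) xor (p xor (y ∧ not b)) xor c xor d) ≡ true
  xor-c-YXX p a b c d refl = trans
    (solve 5 (λ p a b c d →
        (p :+ (con true :+ a)) :+ ((p :+ (con true :+ b)) :+ (c :+ d)) := a :+ (b :+ (c :+ d)))
      refl p a b c d)

  xor-c-YXY : ∀ a b c d e f {y₁ x y₂} → y₁ ≡ true → x ≡ true → y₂ ≡ false →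
    (a xor b xor c xor d) ≡ true → (e xor f) ≡ true →
    ((a xor (y₁ ∧ not f)) xor b xor (e xor (x ∧ c)) xor (d xor (y₂ ∧ not f))) ≡ true
  xor-c-YXY a b c d e f refl refl refl = xor-sum
    (solve 6 (λ a b c d e f →
        (a :+ (con true :+ f)) :+ (b :+ ((e :+ c) :+ (d :+ con false)))
      := ((a :+ (b :+ (c :+ d))) :+ (e :+ f)) :+ con true)
      refl a b c d e f)

module Gluing (G : Graph) (s : Split G) where
  private
    module PX = Piece G (side s) (X' s)
    module PY = Piece G (λ v → not (side s v)) (Y' s)
    variable
      u v w x : Fin (n G)

  open PX using () renaming (toPiece to toX)
  open PY using () renaming (toPiece to toY)

  private
    in-Y : side s u ≡ false → not (side s u) ≡ true
    in-Y = cong not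

  data Side (u : Fin (n G)) : Set where
    X-side : side s u ≡ true  → Side u
    Y-side : side s u ≡ false → Side u

  side? : ∀ u → Side u
  side? u with side s u in eq
  ... | true  = X-side eq
  ... | false = Y-side eq

  flip : ∀ {e} → adj G u v ≡ e → adj G v u ≡ e
  flip = trans (Graph.sym G _ _)

  edge-XY : side s u ≡ true → side s v ≡ false → adj G u v ≡ true → X' s u ≡ true × Y' s v ≡ true
  edge-XY hu hv uv = to ∧-true⇔ (trans (sym (cross s _ _ hu hv)) uv)

  non-edge-XY : side s u ≡ true → side s v ≡ false → adj G u v ≡ false → (X' s u ∧ Y' s v) ≡ false
  non-edge-XY hu hv uv = trans (sym (cross s _ _ hu hv)) uv

  module _ (bX : Fin (n (G-X G s)) → Fin (n (G-X G s)) → Bool)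
           (bY : Fin (n (G-Y G s)) → Fin (n (G-Y G s)) → Bool) where

    -- Vertex zero is y₀ in G-X G s and x₀ in G-Y G s.
    glue′ : Bool → Bool → Fin (n G) → Fin (n G) → Bool
    glue′ true  true  u v = bX (toX u) (toX v)
    glue′ true  false u v = bX (toX u) zero xor (X' s u ∧ bY zero (toY v))
    glue′ false true  u v = bY (toY u) zero xor (Y' s u ∧ not (bX zero (toX v)))
    glue′ false false u v = bY (toY u) (toY v)

    glue : Fin (n G) → Fin (n G) → Bool
    glue u v = glue′ (side s u) (side s v) u v

    glue-XX : side s u ≡ true → side s v ≡ true → glue u v ≡ bX (toX u) (toX v)
    glue-XX {u} {v} hu hv = cong₂ (λ p q → glue′ p q u v) hu hv

    glue-XY : side s u ≡ true → side s v ≡ false →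
      glue u v ≡ bX (toX u) zero xor (X' s u ∧ bY zero (toY v))
    glue-XY {u} {v} hu hv = cong₂ (λ p q → glue′ p q u v) hu hv

    glue-YX : side s u ≡ false → side s v ≡ true →
      glue u v ≡ bY (toY u) zero xor (Y' s u ∧ not (bX zero (toX v)))
    glue-YX {u} {v} hu hv = cong₂ (λ p q → glue′ p q u v) hu hv

    glue-YY : side s u ≡ false → side s v ≡ false → glue u v ≡ bY (toY u) (toY v)
    glue-YY {u} {v} hu hv = cong₂ (λ p q → glue′ p q u v) hu hv

    module _ (SX : NajiSolution (G-X G s) bX) (SY : NajiSolution (G-Y G s) bY) where
      private
        module SX = NajiSolution SX
        module SY = NajiSolution SY

      glue-diag : ∀ v → glue v v ≡ false
      glue-diag v with side? v
      ... | X-side hv = trans (glue-XX hv hv) (SX.diag (toX v))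
      ... | Y-side hv = trans (glue-YY hv hv) (SY.diag (toY v))

      naji-a-XX : side s v ≡ true → side s w ≡ true → NajiA G glue v w
      naji-a-XX {v} {w} hv hw v≢w vw rewrite glue-XX hv hw | glue-XX hw hv =
        SX.naji-a (toX v) (toX w) (PX.toPiece-≢ hv hw v≢w) (trans (PX.adj-toPiece hv hw) vw)

      naji-a-YY : side s v ≡ false → side s w ≡ false → NajiA G glue v w
      naji-a-YY {v} {w} hv hw v≢w vw rewrite glue-YY hv hw | glue-YY hw hv =
        SY.naji-a (toY v) (toY w) (PY.toPiece-≢ (in-Y hv) (in-Y hw) v≢w)
          (trans (PY.adj-toPiece (in-Y hv) (in-Y hw)) vw)

      naji-a-XY : side s v ≡ true → side s w ≡ false → NajiA G glue v w
      naji-a-XY {v} {w} hv hw _ vw rewrite glue-XY hv hw | glue-YX hw hv =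
        xor-a-XY (bX (toX v) zero) (bY zero (toY w)) (bY (toY w) zero) (bX zero (toX v)) X'v Y'w
        (SX.naji-a (toX v) zero (PX.toPiece≢new hv) (trans (PX.adj-toPiece-new hv) X'v))
        (SY.naji-a zero (toY w) (PY.new≢toPiece (in-Y hw)) (trans (PY.adj-new-toPiece (in-Y hw)) Y'w))
        where
        X'v = proj₁ (edge-XY hv hw vw)
        Y'w = proj₂ (edge-XY hv hw vw)

      glue-naji-a : ∀ v w → NajiA G glue v w
      glue-naji-a v w with side? v | side? w
      ... | X-side hv | X-side hw = naji-a-XX hv hw
      ... | X-side hv | Y-side hw = naji-a-XY hv hw
      ... | Y-side hv | X-side hw = NajiA-swap G glue (naji-a-XY hw hv)
      ... | Y-side hv | Y-side hw = naji-a-YY hv hw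

      naji-b-XXX : side s v ≡ true → side s w ≡ true → side s x ≡ true → NajiB G glue v w x
      naji-b-XXX {v} {w} {x} hv hw hx v≢w v≢x w≢x vw vx wx rewrite glue-XX hx hv | glue-XX hx hw =
        SX.naji-b (toX v) (toX w) (toX x)
          (PX.toPiece-≢ hv hw v≢w) (PX.toPiece-≢ hv hx v≢x) (PX.toPiece-≢ hw hx w≢x)
          (trans (PX.adj-toPiece hv hw) vw) (trans (PX.adj-toPiece hv hx) vx) (trans (PX.adj-toPiece hw hx) wx)

      naji-b-YYY : side s v ≡ false → side s w ≡ false → side s x ≡ false → NajiB G glue v w x
      naji-b-YYY {v} {w} {x} hv hw hx v≢w v≢x w≢x vw vx wx rewrite glue-YY hx hv | glue-YY hx hw =
        SY.naji-b (toY v) (toY w) (toY x)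
          (PY.toPiece-≢ hv′ hw′ v≢w) (PY.toPiece-≢ hv′ hx′ v≢x) (PY.toPiece-≢ hw′ hx′ w≢x)
          (trans (PY.adj-toPiece hv′ hw′) vw) (trans (PY.adj-toPiece hv′ hx′) vx)
          (trans (PY.adj-toPiece hw′ hx′) wx)
        where
        hv′ = in-Y hv
        hw′ = in-Y hw
        hx′ = in-Y hx

      naji-b-XXY : side s v ≡ true → side s w ≡ true → side s x ≡ false → NajiB G glue v w x
      naji-b-XXY {v} {w} {x} hv hw hx v≢w _ _ vw vx wx
        rewrite glue-YX hx hv | glue-YX hx hw with Y' s x in Y'x
      ... | false = refl
      ... | true  = cong (λ z → bY (toY x) zero xor not z)
        (SX.naji-b (toX v) (toX w) zero
          (PX.toPiece-≢ hv hw v≢w) (PX.toPiece≢new hv) (PX.toPiece≢new hw) (trans (PX.adj-toPiece hv hw) vw)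
          (trans (PX.adj-toPiece-new hv) (∧≡false⇒ˡ (non-edge-XY hv hx vx) Y'x))
          (trans (PX.adj-toPiece-new hw) (∧≡false⇒ˡ (non-edge-XY hw hx wx) Y'x)))

      naji-b-YYX : side s v ≡ false → side s w ≡ false → side s x ≡ true → NajiB G glue v w x
      naji-b-YYX {v} {w} {x} hv hw hx v≢w _ _ vw vx wx
        rewrite glue-XY hx hv | glue-XY hx hw with X' s x in X'x
      ... | false = refl
      ... | true  = cong (bX (toX x) zero xor_)
        (SY.naji-b (toY v) (toY w) zero
          (PY.toPiece-≢ (in-Y hv) (in-Y hw) v≢w) (PY.toPiece≢new (in-Y hv)) (PY.toPiece≢new (in-Y hw))
          (trans (PY.adj-toPiece (in-Y hv) (in-Y hw)) vw)
          (trans (PY.adj-toPiece-new (in-Y hv)) (∧≡false⇒ʳ (non-edge-XY hx hv (flip vx)) X'x))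
          (trans (PY.adj-toPiece-new (in-Y hw)) (∧≡false⇒ʳ (non-edge-XY hx hw (flip wx)) X'x)))

      naji-b-XYX : side s v ≡ true → side s w ≡ false → side s x ≡ true → NajiB G glue v w x
      naji-b-XYX {v} {w} {x} hv hw hx _ v≢x _ vw vx wx
        rewrite glue-XX hx hv | glue-XY hx hw = trans
          (SX.naji-b (toX v) zero (toX x) (PX.toPiece≢new hv) (PX.toPiece-≢ hv hx v≢x) (PX.new≢toPiece hx)
            (trans (PX.adj-toPiece-new hv) (proj₁ (edge-XY hv hw vw)))
            (trans (PX.adj-toPiece hv hx) vx) (trans (PX.adj-new-toPiece hx) X'x))
          (sym (xor-false∧ _ X'x))
        where
        X'x = ∧≡false⇒ˡ (non-edge-XY hx hw (flip wx)) (proj₂ (edge-XY hv hw vw))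

      naji-b-XYY : side s v ≡ true → side s w ≡ false → side s x ≡ false → NajiB G glue v w x
      naji-b-XYY {v} {w} {x} hv hw hx _ _ w≢x vw vx wx
        rewrite glue-YX hx hv | glue-YY hx hw = trans
          (xor-false∧ _ Y'x)
          (SY.naji-b zero (toY w) (toY x) (PY.new≢toPiece (in-Y hw)) (PY.new≢toPiece (in-Y hx))
            (PY.toPiece-≢ (in-Y hw) (in-Y hx) w≢x)
            (trans (PY.adj-new-toPiece (in-Y hw)) (proj₂ (edge-XY hv hw vw)))
            (trans (PY.adj-new-toPiece (in-Y hx)) Y'x) (trans (PY.adj-toPiece (in-Y hw) (in-Y hx)) wx))
        where
        Y'x = ∧≡false⇒ʳ (non-edge-XY hv hx vx) (proj₁ (edge-XY hv hw vw))

      glue-naji-b : ∀ v w x → NajiB G glue v w x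
      glue-naji-b v w x with side? v | side? w | side? x
      ... | X-side hv | X-side hw | X-side hx = naji-b-XXX hv hw hx
      ... | X-side hv | X-side hw | Y-side hx = naji-b-XXY hv hw hx
      ... | X-side hv | Y-side hw | X-side hx = naji-b-XYX hv hw hx
      ... | X-side hv | Y-side hw | Y-side hx = naji-b-XYY hv hw hx
      ... | Y-side hv | X-side hw | X-side hx = NajiB-swap G glue (naji-b-XYX hw hv hx)
      ... | Y-side hv | X-side hw | Y-side hx = NajiB-swap G glue (naji-b-XYY hw hv hx)
      ... | Y-side hv | Y-side hw | X-side hx = naji-b-YYX hv hw hx
      ... | Y-side hv | Y-side hw | Y-side hx = naji-b-YYY hv hw hx

      naji-c-XXX : side s v ≡ true → side s w ≡ true → side s x ≡ true → NajiC G glue v w x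
      naji-c-XXX {v} {w} {x} hv hw hx v≢w v≢x w≢x vw vx wx
        rewrite glue-XX hv hw | glue-XX hv hx | glue-XX hw hx | glue-XX hx hw =
        SX.naji-c (toX v) (toX w) (toX x)
          (PX.toPiece-≢ hv hw v≢w) (PX.toPiece-≢ hv hx v≢x) (PX.toPiece-≢ hw hx w≢x)
          (trans (PX.adj-toPiece hv hw) vw) (trans (PX.adj-toPiece hv hx) vx) (trans (PX.adj-toPiece hw hx) wx)

      naji-c-YYY : side s v ≡ false → side s w ≡ false → side s x ≡ false → NajiC G glue v w x
      naji-c-YYY {v} {w} {x} hv hw hx v≢w v≢x w≢x vw vx wx
        rewrite glue-YY hv hw | glue-YY hv hx | glue-YY hw hx | glue-YY hx hw =
        SY.naji-c (toY v) (toY w) (toY x)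
          (PY.toPiece-≢ hv′ hw′ v≢w) (PY.toPiece-≢ hv′ hx′ v≢x) (PY.toPiece-≢ hw′ hx′ w≢x)
          (trans (PY.adj-toPiece hv′ hw′) vw) (trans (PY.adj-toPiece hv′ hx′) vx)
          (trans (PY.adj-toPiece hw′ hx′) wx)
        where
        hv′ = in-Y hv
        hw′ = in-Y hw
        hx′ = in-Y hx

      naji-c-XXY : side s v ≡ true → side s w ≡ true → side s x ≡ false → NajiC G glue v w x
      naji-c-XXY {v} {w} {x} hv hw hx v≢w _ _ vw vx wx
        rewrite glue-XX hv hw | glue-XY hv hx | glue-XY hw hx | glue-YX hx hw =
        xor-c-XXY (bX (toX v) (toX w)) (bX (toX v) zero) (bX (toX w) zero) (bX zero (toX w))
                  (bY zero (toY x)) (bY (toY x) zero) X'v X'w Y'x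
          (SX.naji-c (toX v) (toX w) zero
            (PX.toPiece-≢ hv hw v≢w) (PX.toPiece≢new hv) (PX.toPiece≢new hw) (trans (PX.adj-toPiece hv hw) vw)
            (trans (PX.adj-toPiece-new hv) X'v) (trans (PX.adj-toPiece-new hw) X'w))
          (SY.naji-a zero (toY x) (PY.new≢toPiece (in-Y hx)) (trans (PY.adj-new-toPiece (in-Y hx)) Y'x))
        where
        X'v = proj₁ (edge-XY hv hx vx)
        Y'x = proj₂ (edge-XY hv hx vx)
        X'w = ∧≡false⇒ˡ (non-edge-XY hw hx wx) Y'x

      naji-c-XYY : side s v ≡ true → side s w ≡ false → side s x ≡ false → NajiC G glue v w x
      naji-c-XYY {v} {w} {x} hv hw hx _ _ w≢x vw vx wx
        rewrite glue-XY hv hw | glue-XY hv hx | glue-YY hw hx | glue-YY hx hw =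
        xor-c-XYY (bX (toX v) zero) (bY zero (toY w)) (bY zero (toY x)) (bY (toY w) (toY x))
                  (bY (toY x) (toY w)) (proj₁ (edge-XY hv hw vw))
          (SY.naji-c zero (toY w) (toY x)
            (PY.new≢toPiece (in-Y hw)) (PY.new≢toPiece (in-Y hx)) (PY.toPiece-≢ (in-Y hw) (in-Y hx) w≢x)
            (trans (PY.adj-new-toPiece (in-Y hw)) (proj₂ (edge-XY hv hw vw)))
            (trans (PY.adj-new-toPiece (in-Y hx)) (proj₂ (edge-XY hv hx vx)))
            (trans (PY.adj-toPiece (in-Y hw) (in-Y hx)) wx))

      naji-c-YXX : side s v ≡ false → side s w ≡ true → side s x ≡ true → NajiC G glue v w x
      naji-c-YXX {v} {w} {x} hv hw hx _ _ w≢x vw vx wx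
        rewrite glue-YX hv hw | glue-YX hv hx | glue-XX hw hx | glue-XX hx hw =
        xor-c-YXX (bY (toY v) zero) (bX zero (toX w)) (bX zero (toX x)) (bX (toX w) (toX x))
                  (bX (toX x) (toX w)) (proj₂ (edge-XY hw hv (flip vw)))
          (SX.naji-c zero (toX w) (toX x)
            (PX.new≢toPiece hw) (PX.new≢toPiece hx) (PX.toPiece-≢ hw hx w≢x)
            (trans (PX.adj-new-toPiece hw) (proj₁ (edge-XY hw hv (flip vw))))
            (trans (PX.adj-new-toPiece hx) (proj₁ (edge-XY hx hv (flip vx))))
            (trans (PX.adj-toPiece hw hx) wx))

      naji-c-YXY : side s v ≡ false → side s w ≡ true → side s x ≡ false → NajiC G glue v w x
      naji-c-YXY {v} {w} {x} hv hw hx _ v≢x _ vw vx wx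
        rewrite glue-YX hv hw | glue-YY hv hx | glue-XY hw hx | glue-YX hx hw =
        xor-c-YXY (bY (toY v) zero) (bY (toY v) (toY x)) (bY zero (toY x)) (bY (toY x) zero)
                  (bX (toX w) zero) (bX zero (toX w)) Y'v X'w Y'x
          (SY.naji-c (toY v) zero (toY x)
            (PY.toPiece≢new (in-Y hv)) (PY.toPiece-≢ (in-Y hv) (in-Y hx) v≢x) (PY.new≢toPiece (in-Y hx))
            (trans (PY.adj-toPiece-new (in-Y hv)) Y'v) (trans (PY.adj-toPiece (in-Y hv) (in-Y hx)) vx)
            (trans (PY.adj-new-toPiece (in-Y hx)) Y'x))
          (SX.naji-a (toX w) zero (PX.toPiece≢new hw) (trans (PX.adj-toPiece-new hw) X'w))
        where
        X'w = proj₁ (edge-XY hw hv (flip vw))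
        Y'v = proj₂ (edge-XY hw hv (flip vw))
        Y'x = ∧≡false⇒ʳ (non-edge-XY hw hx wx) X'w

      glue-naji-c : ∀ v w x → NajiC G glue v w x
      glue-naji-c v w x with side? v | side? w | side? x
      ... | X-side hv | X-side hw | X-side hx = naji-c-XXX hv hw hx
      ... | X-side hv | X-side hw | Y-side hx = naji-c-XXY hv hw hx
      ... | X-side hv | Y-side hw | X-side hx = NajiC-swap G glue (naji-c-XXY hv hx hw)
      ... | X-side hv | Y-side hw | Y-side hx = naji-c-XYY hv hw hx
      ... | Y-side hv | X-side hw | X-side hx = naji-c-YXX hv hw hx
      ... | Y-side hv | X-side hw | Y-side hx = naji-c-YXY hv hw hx
      ... | Y-side hv | Y-side hw | X-side hx = NajiC-swap G glue (naji-c-YXY hv hx hw)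
      ... | Y-side hv | Y-side hw | Y-side hx = naji-c-YYY hv hw hx

      glue-solution : NajiSolution G glue
      glue-solution = record
        { diag = glue-diag ; naji-a = glue-naji-a ; naji-b = glue-naji-b ; naji-c = glue-naji-c }

  module _ {x* y*} (X'x* : X' s x* ≡ true) (Y'y* : Y' s y* ≡ true)
           {bX bX′ bY bY′} (SX : NajiSolution (G-X G s) bX) (SX′ : NajiSolution (G-X G s) bX′)
           (SY : NajiSolution (G-Y G s) bY) (SY′ : NajiSolution (G-Y G s) bY′)
           (same-glue : ∀ u v → glue bX bY u v ≡ glue bX′ bY′ u v)
           (same-bit : bX (toX x*) zero ≡ bX′ (toX x*) zero) where
    private
      hx* = X'⊆X s x* X'x*
      hy* = Y'⊆Y s y* Y'y*
      module SX = NajiSolution SX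
      module SX′ = NajiSolution SX′
      module SY = NajiSolution SY
      module SY′ = NajiSolution SY′

      same-XY : side s u ≡ true → side s v ≡ false →
        (bX (toX u) zero xor (X' s u ∧ bY zero (toY v))) ≡
        (bX′ (toX u) zero xor (X' s u ∧ bY′ zero (toY v)))
      same-XY {u} {v} hu hv = trans (sym (glue-XY bX bY hu hv)) (trans (same-glue u v) (glue-XY bX′ bY′ hu hv))

      same-YX : side s u ≡ false → side s v ≡ true →
        (bY (toY u) zero xor (Y' s u ∧ not (bX zero (toX v)))) ≡
        (bY′ (toY u) zero xor (Y' s u ∧ not (bX′ zero (toX v))))
      same-YX {u} {v} hu hv = trans (sym (glue-YX bX bY hu hv)) (trans (same-glue u v) (glue-YX bX′ bY′ hu hv))

      same-new-Y : side s v ≡ false → bY zero (toY v) ≡ bY′ zero (toY v)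
      same-new-Y hv = xor-∧-cancelˡ X'x* (same-XY hx* hv) same-bit

      same-X-new : side s u ≡ true → bX (toX u) zero ≡ bX′ (toX u) zero
      same-X-new {u} hu = xor-cancelʳ (same-XY hu hy*) (cong (X' s u ∧_) (same-new-Y hy*))

      same-y*-new : bY (toY y*) zero ≡ bY′ (toY y*) zero
      same-y*-new = xor-cancelˡ (trans (edge SY) (sym (edge SY′))) (same-new-Y hy*)
        where
        edge : ∀ {b} → NajiSolution (G-Y G s) b → (b zero (toY y*) xor b (toY y*) zero) ≡ true
        edge S = NajiSolution.naji-a S zero (toY y*) (PY.new≢toPiece (in-Y hy*))
          (trans (PY.adj-new-toPiece (in-Y hy*)) Y'y*)

      same-new-X : side s u ≡ true → bX zero (toX u) ≡ bX′ zero (toX u)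
      same-new-X hu = not-injective (xor-∧-cancelˡ Y'y* (same-YX hy* hu) same-y*-new)

      same-Y-new : side s v ≡ false → bY (toY v) zero ≡ bY′ (toY v) zero
      same-Y-new {v} hv = xor-cancelʳ (same-YX hv hx*) (cong (λ z → Y' s v ∧ not z) (same-new-X hx*))

    glue-determines-X : ∀ a c → bX a c ≡ bX′ a c
    glue-determines-X a c with PX.pieceView a | PX.pieceView c
    ... | PX.new    | PX.new    = trans (SX.diag zero) (sym (SX′.diag zero))
    ... | PX.new    | PX.old hc = same-new-X hc
    ... | PX.old ha | PX.new    = same-X-new ha
    ... | PX.old ha | PX.old hc =
      trans (sym (glue-XX bX bY ha hc)) (trans (same-glue _ _) (glue-XX bX′ bY′ ha hc))

    glue-determines-Y : ∀ a c → bY a c ≡ bY′ a c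
    glue-determines-Y a c with PY.pieceView a | PY.pieceView c
    ... | PY.new    | PY.new    = trans (SY.diag zero) (sym (SY′.diag zero))
    ... | PY.new    | PY.old hc = same-new-Y (to not-true⇔ hc)
    ... | PY.old ha | PY.new    = same-Y-new (to not-true⇔ ha)
    ... | PY.old ha | PY.old hc =
      trans (sym (glue-YY bX bY (to not-true⇔ ha) (to not-true⇔ hc)))
        (trans (same-glue _ _) (glue-YY bX′ bY′ (to not-true⇔ ha) (to not-true⇔ hc)))

  NajiGraph-glue : NajiGraph (G-X G s) → NajiGraph (G-Y G s) → NajiGraph G
  NajiGraph-glue (tX , tX∈𝓑) (tY , tY∈𝓑) = NajiSolution⇒NajiGraph
    (glue-solution (β tX) (β tY) (to (In𝓑⇔NajiSolution {t = tX}) tX∈𝓑)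
                                 (to (In𝓑⇔NajiSolution {t = tY}) tY∈𝓑))

  #𝓑-glue : ∀ {x y} → X' s x ≡ true → Y' s y ≡ true → #𝓑 (G-X G s) * #𝓑 (G-Y G s) ≤ 2 * #𝓑 G
  #𝓑-glue {x} X'x Y'y = length*length≤ (𝓑-unique (G-X G s)) (𝓑-unique (G-Y G s)) glue-table colour
    (λ tX∈ tY∈ → ∈-𝓑⁺ G (proj₂ (NajiSolution⇒NajiGraph
      (glue-solution _ _ (solution-of tX∈) (solution-of tY∈)))))
    glue-table-injective
    where
    glue-table : Table (n (G-X G s)) → Table (n (G-Y G s)) → Table (n G)
    glue-table tX tY = tabulate₂ (glue (β tX) (β tY))
    colour : Table (n (G-X G s)) → Fin 2
    colour tX = Inverse.from 2↔Bool (β tX (toX x) zero)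
    solution-of : ∀ {H t} → t ∈ 𝓑 H → NajiSolution H (β t)
    solution-of {H} {t} t∈ = to (In𝓑⇔NajiSolution {t = t}) (∈-𝓑⁻ H t∈)
    glue-table-injective : ∀ {tX tY tX′ tY′} → tX ∈ 𝓑 (G-X G s) → tY ∈ 𝓑 (G-Y G s) →
      tX′ ∈ 𝓑 (G-X G s) → tY′ ∈ 𝓑 (G-Y G s) →
      colour tX ≡ colour tX′ → glue-table tX tY ≡ glue-table tX′ tY′ → tX ≡ tX′ × tY ≡ tY′
    glue-table-injective {tX} {tY} {tX′} {tY′} tX∈ tY∈ tX′∈ tY′∈ same-colour same-table =
      Table-ext (glue-determines-X X'x Y'y SX SX′ SY SY′ same-glue same-bit) ,
      Table-ext (glue-determines-Y X'x Y'y SX SX′ SY SY′ same-glue same-bit)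
      where
      SX = solution-of tX∈
      SX′ = solution-of tX′∈
      SY = solution-of tY∈
      SY′ = solution-of tY′∈
      same-glue : ∀ u v → glue (β tX) (β tY) u v ≡ glue (β tX′) (β tY′) u v
      same-glue u v =
        trans (sym (β-tabulate₂ _ u v)) (trans (cong (λ t → β t u v) same-table) (β-tabulate₂ _ u v))
      same-bit : β tX (toX x) zero ≡ β tX′ (toX x) zero
      same-bit = trans (sym (Inverse.strictlyInverseˡ 2↔Bool _))
        (trans (cong (Inverse.to 2↔Bool) same-colour) (Inverse.strictlyInverseˡ 2↔Bool _))

proposition25 : (G : Graph) → Connected G → (s : Split G) →
    (NajiGraph G ⇔ (NajiGraph (G-X G s) × NajiGraph (G-Y G s)))
    × (#𝓑 (G-X G s) * #𝓑 (G-Y G s) ≤ 2 * #𝓑 G)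
proposition25 G connected s with attachments G s connected
... | x , y , X'x , Y'y =
  mk⇔ (λ naji → NajiGraph-G-X G s Y'y naji , NajiGraph-G-Y G s X'x naji)
      (uncurry (Gluing.NajiGraph-glue G s))
  , Gluing.#𝓑-glue G s X'x Y'y
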